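{- Let $k$ be a positive integer. (1) There are at most $\mathit{Tower}(k+\log^*k+3)$ pairwise inequivalent first-order sentences about graphs of quantifier depth $k$. (2) Every first-order sentence $\Phi$ about graphs of quantifier depth $k$ has an equivalent sentence $\Phi'$ with the same quantifier depth and length $L(\Phi')<3\,\mathit{Tower}(k+\log^*k+2)^2$.
   Context: Graphs are finite, simple, undirected, with non-empty vertex set. First-order sentences about graphs have variables ranging over vertices, relation symbols $\sim$ (adjacency) and $=$ (equality), Boolean connectives and quantifiers $\exists,\forall$. The quantifier depth is the maximum length of a chain of nested quantifiers; the length is the total number of symbols (each occurrence of a variable symbol contributes 1). Two sentences are equivalent if they are true on exactly the same graphs. $\mathit{Tower}(0)=1$, $\mathit{Tower}(i)=2^{\mathit{Tower}(i-1)}$; $\log^*n=\min\{i:\mathit{Tower}(i)\ge n\}$. -}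

module Defs where

open import Data.Nat using (ℕ; zero; suc; _+_; _*_; _^_; _⊔_; _≤_; _<_; _≡ᵇ_)
open import Data.Bool using (Bool; true; false; not; _∧_; _∨_; if_then_else_)
open import Data.Fin using (Fin; zero; suc)
import Data.Fin as Fin
open import Relation.Nullary.Decidable using (⌊_⌋)
open import Relation.Binary.PropositionalEquality using (_≡_)

Tower : ℕ → ℕ
Tower zero    = 1
Tower (suc i) = 2 ^ Tower i

-- l is log* n, i.e. l = min { i : Tower i ≥ n }  (literal definition of the minimum)
IsLogStar : ℕ → ℕ → Set
IsLogStar n l = (n ≤ Tower l) × ((i : ℕ) → i < l → Tower i < n)
  where open import Data.Product using (_×_)

record Graph : Set where
  field
    m     : ℕ
    adj   : Fin (suc m) → Fin (suc m) → Bool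
    sym   : ∀ u v → adj u v ≡ adj v u
    irrefl : ∀ v → adj v v ≡ false

Vertex : Graph → Set
Vertex G = Fin (suc (Graph.m G))

data BinOp : Set where
  and or imp iff : BinOp

data Quant : Set where
  ex all : Quant

data Formula : Set where
  adjF : ℕ → ℕ → Formula
  eqF  : ℕ → ℕ → Formula
  negF : Formula → Formula
  binF : BinOp → Formula → Formula → Formula
  qF   : Quant → ℕ → Formula → Formula

free : ℕ → Formula → Bool
free x (adjF y z)   = (x ≡ᵇ y) ∨ (x ≡ᵇ z)
free x (eqF y z)    = (x ≡ᵇ y) ∨ (x ≡ᵇ z)
free x (negF φ)     = free x φ
free x (binF _ φ ψ) = free x φ ∨ free x ψ
free x (qF _ y φ)   = not (x ≡ᵇ y) ∧ free x φ

IsSentence : Formula → Set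
IsSentence φ = (x : ℕ) → free x φ ≡ false

qd : Formula → ℕ
qd (adjF _ _)   = 0
qd (eqF _ _)    = 0
qd (negF φ)     = qd φ
qd (binF _ φ ψ) = qd φ ⊔ qd ψ
qd (qF _ _ φ)   = suc (qd φ)

-- length = total number of symbols; every variable occurrence counts 1,
-- binary connectives come with a pair of parentheses.
len : Formula → ℕ
len (adjF _ _)   = 3
len (eqF _ _)    = 3
len (negF φ)     = 1 + len φ
len (binF _ φ ψ) = 3 + len φ + len ψ
len (qF _ _ φ)   = 2 + len φ

anyFin : (n : ℕ) → (Fin n → Bool) → Bool
anyFin zero    f = false
anyFin (suc n) f = f zero ∨ anyFin n (λ i → f (suc i))

allFin : (n : ℕ) → (Fin n → Bool) → Bool
allFin zero    f = true
allFin (suc n) f = f zero ∧ allFin n (λ i → f (suc i))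

evalOp : BinOp → Bool → Bool → Bool
evalOp and a b = a ∧ b
evalOp or  a b = a ∨ b
evalOp imp a b = not a ∨ b
evalOp iff a b = if a then b else not b

eval : (G : Graph) → (ℕ → Vertex G) → Formula → Bool
eval G ρ (adjF x y)   = Graph.adj G (ρ x) (ρ y)
eval G ρ (eqF x y)    = ⌊ ρ x Fin.≟ ρ y ⌋
eval G ρ (negF φ)     = not (eval G ρ φ)
eval G ρ (binF o φ ψ) = evalOp o (eval G ρ φ) (eval G ρ ψ)
eval G ρ (qF ex x φ)  = anyFin (suc (Graph.m G)) (λ v → eval G (λ y → if y ≡ᵇ x then v else ρ y) φ)
eval G ρ (qF all x φ) = allFin (suc (Graph.m G)) (λ v → eval G (λ y → if y ≡ᵇ x then v else ρ y) φ)

-- truth of a sentence (assignment irrelevant for sentences; use the constant one)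
holds : Graph → Formula → Bool
holds G φ = eval G (λ _ → zero) φ

Equivalent : Formula → Formula → Set
Equivalent φ ψ = (G : Graph) → holds G φ ≡ holds G ψ

-- A graph G, an assignment ρ and a depth d determine the d-type of the tuple
-- (ρ 0, …, ρ (j − 1)): at depth 0 the adjacencies and equalities among its
-- entries, at depth d + 1 the set of d-types of its one-point extensions.
-- Coding sets as numbers, d-types of j-tuples live below #types d j, where
-- #types 0 j = 2^(j²) and #types (d + 1) j = 2^(#types d (j + 1)), and the
-- truth of a formula of depth ≤ d is a function of the d-type.  So a sentence
-- of depth k is determined by a set of k-types of the empty tuple, which gives
-- at most 2^(#types k 0) inequivalent sentences, and it is equivalent to the
-- disjunction of the Hintikka formulas of the types in that set.  Both bounds
-- then follow from #types k 0 ≤ Tower (k + log* k + 2) and a length estimate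
-- for Hintikka formulas.
module Submission where

open import Defs
open import Data.Bool using (Bool; true; false; not; _∧_; _∨_; if_then_else_; T)
open import Data.Bool.Properties
  using (∨-zeroʳ; ∨-identityʳ; ∧-identityʳ; ∨-idem; ∨-inverseˡ; ∧-assoc; ∨-assoc)
open import Data.Fin using (Fin; zero; suc; toℕ; fromℕ<; combine; remQuot; funToFin; finToFun)
import Data.Fin as Fin
open import Data.Fin.Properties
  using (2↔Bool; finToFun-funToFin; funToFin-finToFin; remQuot-combine; toℕ-fromℕ<; toℕ<n; injective⇒≤)
open import Data.Nat
  using (ℕ; zero; suc; _+_; _*_; _^_; _⊔_; _≤_; _<_; _≤′_; _≡ᵇ_; _<ᵇ_; _<?_; z≤n; s≤s; z<s; ≤′-refl; ≤′-step)
open import Data.Nat.Properties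
open import Algebra.Properties.CommutativeSemigroup *-commutativeSemigroup using (x∙yz≈y∙xz)
open import Data.Nat.Tactic.RingSolver using (solve-∀)
open import Data.Product using (Σ; ∃; _×_; _,_; proj₁; proj₂)
open import Data.Unit using (tt)
open import Function using (_∘_; Inverse)
open import Relation.Nullary using (¬_; yes; no; contradiction)
open import Relation.Nullary.Decidable using (⌊_⌋)
open import Relation.Binary.PropositionalEquality

bool-ext : ∀ {a b} → (a ≡ true → b ≡ true) → (b ≡ true → a ≡ true) → a ≡ b
bool-ext {true}  {true}  _ _ = refl
bool-ext {true}  {false} f _ = sym (f refl)
bool-ext {false} {true}  _ g = g refl
bool-ext {false} {false} _ _ = refl

∨-introˡ : ∀ {a} b → a ≡ true → a ∨ b ≡ true
∨-introˡ b refl = refl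

∨-introʳ : ∀ a {b} → b ≡ true → a ∨ b ≡ true
∨-introʳ a refl = ∨-zeroʳ a

∧-intro : ∀ {a b} → a ≡ true → b ≡ true → a ∧ b ≡ true
∧-intro refl refl = refl

∧-elim : ∀ a {b} → a ∧ b ≡ true → a ≡ true × b ≡ true
∧-elim true e = refl , e

infix 7 _⇔ᵇ_ _==_

_⇔ᵇ_ : Bool → Bool → Bool
a ⇔ᵇ b = if a then b else not b

⇔ᵇ-true : ∀ a b → a ⇔ᵇ b ≡ true → a ≡ b
⇔ᵇ-true true  true  _ = refl
⇔ᵇ-true false false _ = refl

⇔ᵇ-refl : ∀ a → a ⇔ᵇ a ≡ true
⇔ᵇ-refl true  = refl
⇔ᵇ-refl false = refl

_==_ : ∀ {n} → Fin n → Fin n → Bool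
x == y = ⌊ x Fin.≟ y ⌋

==-true : ∀ {n} {x y : Fin n} → x == y ≡ true → x ≡ y
==-true {x = x} {y} e with x Fin.≟ y
... | yes x≡y = x≡y

==-refl : ∀ {n} (x : Fin n) → x == x ≡ true
==-refl x with x Fin.≟ x
... | yes _   = refl
... | no  x≢x = contradiction refl x≢x

==-sym : ∀ {n} (x y : Fin n) → x == y ≡ y == x
==-sym x y = bool-ext (λ e → subst (λ z → z == x ≡ true) (==-true e) (==-refl x))
                      (λ e → subst (λ z → z == y ≡ true) (==-true e) (==-refl y))

≡ᵇ-refl : ∀ n → (n ≡ᵇ n) ≡ true
≡ᵇ-refl zero    = refl
≡ᵇ-refl (suc n) = ≡ᵇ-refl n

≢⇒≡ᵇ-false : ∀ {a b} → a ≢ b → (a ≡ᵇ b) ≡ false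
≢⇒≡ᵇ-false {a} {b} a≢b with a ≡ᵇ b in e
... | false = refl
... | true  = contradiction (≡ᵇ⇒≡ a b (subst T (sym e) tt)) a≢b

>⇒≡ᵇ-false : ∀ {a b} → b < a → (a ≡ᵇ b) ≡ false
>⇒≡ᵇ-false b<a = ≢⇒≡ᵇ-false (>⇒≢ b<a)

≡ᵇ-false⇒≢ : ∀ {a b} → (a ≡ᵇ b) ≡ false → a ≢ b
≡ᵇ-false⇒≢ {a} e refl with () ← trans (sym e) (≡ᵇ-refl a)

<ᵇ-true⇒< : ∀ {a b} → (a <ᵇ b) ≡ true → a < b
<ᵇ-true⇒< {a} {b} e = <ᵇ⇒< a b (subst T (sym e) tt)

<ᵇ-false⇒≮ : ∀ {a b} → (a <ᵇ b) ≡ false → ¬ a < b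
<ᵇ-false⇒≮ e a<b = subst T e (<⇒<ᵇ a<b)

≮ᵇ-both⇒≡ : ∀ {a b} → (a <ᵇ b) ≡ false → (b <ᵇ a) ≡ false → a ≡ b
≮ᵇ-both⇒≡ a≮b b≮a = ≤-antisym (≮⇒≥ (<ᵇ-false⇒≮ b≮a)) (≮⇒≥ (<ᵇ-false⇒≮ a≮b))

anyFin-cong : ∀ n {f g : Fin n → Bool} → (∀ i → f i ≡ g i) → anyFin n f ≡ anyFin n g
anyFin-cong zero    e = refl
anyFin-cong (suc n) e = cong₂ _∨_ (e zero) (anyFin-cong n (e ∘ suc))

allFin-cong : ∀ n {f g : Fin n → Bool} → (∀ i → f i ≡ g i) → allFin n f ≡ allFin n g
allFin-cong zero    e = refl
allFin-cong (suc n) e = cong₂ _∧_ (e zero) (allFin-cong n (e ∘ suc))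

anyFin-witness : ∀ n {f : Fin n → Bool} → anyFin n f ≡ true → ∃ λ i → f i ≡ true
anyFin-witness (suc n) {f} e with f zero in f0
... | true  = zero , f0
... | false = let (i , fi) = anyFin-witness n e in suc i , fi

anyFin-intro : ∀ n {f : Fin n → Bool} i → f i ≡ true → anyFin n f ≡ true
anyFin-intro (suc n) zero    fi = ∨-introˡ _ fi
anyFin-intro (suc n) {f} (suc i) fi = ∨-introʳ (f zero) (anyFin-intro n i fi)

allFin-elim : ∀ n {f : Fin n → Bool} → allFin n f ≡ true → ∀ i → f i ≡ true
allFin-elim (suc n) {f} e zero    = proj₁ (∧-elim (f zero) e)
allFin-elim (suc n) {f} e (suc i) = allFin-elim n (proj₂ (∧-elim (f zero) e)) i

allFin-intro : ∀ n {f : Fin n → Bool} → (∀ i → f i ≡ true) → allFin n f ≡ true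
allFin-intro zero    _ = refl
allFin-intro (suc n) p = ∧-intro (p zero) (allFin-intro n (p ∘ suc))

anyFin-const : ∀ n c → anyFin (suc n) (λ _ → c) ≡ c
anyFin-const zero    c = ∨-identityʳ c
anyFin-const (suc n) c = trans (cong (c ∨_) (anyFin-const n c)) (∨-idem c)

quant : Quant → (n : ℕ) → (Fin n → Bool) → Bool
quant ex  = anyFin
quant all = allFin

quant-cong : ∀ q n {f g : Fin n → Bool} → (∀ i → f i ≡ g i) → quant q n f ≡ quant q n g
quant-cong ex  = anyFin-cong
quant-cong all = allFin-cong

quantIn : Quant → (n : ℕ) → (Fin n → Bool) → (Fin n → Bool) → Bool
quantIn ex  n P F = anyFin n (λ i → P i ∧ F i)
quantIn all n P F = allFin n (λ i → not (P i) ∨ F i)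

quantIn-cong : ∀ q n {P P' F F' : Fin n → Bool} →
  (∀ i → P i ≡ P' i) → (∀ i → F i ≡ F' i) → quantIn q n P F ≡ quantIn q n P' F'
quantIn-cong ex  n p f = anyFin-cong n (λ i → cong₂ _∧_ (p i) (f i))
quantIn-cong all n p f = allFin-cong n (λ i → cong₂ _∨_ (cong not (p i)) (f i))

quantIn-ex-== : ∀ n (P : Fin n → Bool) x → quantIn ex n P (x ==_) ≡ P x
quantIn-ex-== n P x = bool-ext
  (λ e → let (s , Ps∧x==s) = anyFin-witness n e
             (Ps , x==s)   = ∧-elim (P s) Ps∧x==s
         in subst (λ z → P z ≡ true) (sym (==-true x==s)) Ps)
  (λ Px → anyFin-intro n x (∧-intro Px (==-refl x)))

image : ∀ {M N} → (Fin M → Fin N) → Fin N → Bool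
image {M} h s = anyFin M (λ w → h w == s)

anyFin-image : ∀ M {N} (h : Fin M → Fin N) (F : Fin N → Bool) →
  anyFin M (F ∘ h) ≡ quantIn ex N (image h) F
anyFin-image M {N} h F = bool-ext
  (λ e → let (w , Fhw) = anyFin-witness M e in
         anyFin-intro N (h w) (∧-intro (anyFin-intro M w (==-refl (h w))) Fhw))
  (λ e → let (s , s∈h∧Fs) = anyFin-witness N e
             (s∈h , Fs)   = ∧-elim (image h s) s∈h∧Fs
             (w , hw==s)  = anyFin-witness M s∈h
         in anyFin-intro M w (subst (λ z → F z ≡ true) (sym (==-true hw==s)) Fs))

allFin-image : ∀ M {N} (h : Fin M → Fin N) (F : Fin N → Bool) →
  allFin M (F ∘ h) ≡ quantIn all N (image h) F
allFin-image M {N} h F = bool-ext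
  (λ e → allFin-intro N (covered e))
  (λ e → allFin-intro M (λ w → subst (λ z → not z ∨ F (h w) ≡ true)
                                      (anyFin-intro M w (==-refl (h w))) (allFin-elim N e (h w))))
  where
  covered : allFin M (F ∘ h) ≡ true → ∀ s → not (image h s) ∨ F s ≡ true
  covered e s with image h s in s∈h
  ... | false = refl
  ... | true  = let (w , hw==s) = anyFin-witness M s∈h in
                subst (λ z → F z ≡ true) (==-true hw==s) (allFin-elim M e w)

quant-image : ∀ q M {N} (h : Fin M → Fin N) (F : Fin N → Bool) →
  quant q M (F ∘ h) ≡ quantIn q N (image h) F
quant-image ex  = anyFin-image
quant-image all = allFin-image

-- Coding subsets of Fin n by Fin (2 ^ n)

encode : ∀ n → (Fin n → Bool) → Fin (2 ^ n)
encode n P = funToFin (Inverse.from 2↔Bool ∘ P)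

decode : ∀ n → Fin (2 ^ n) → Fin n → Bool
decode n t = Inverse.to 2↔Bool ∘ finToFun {2} {n} t

decode-encode : ∀ n P i → decode n (encode n P) i ≡ P i
decode-encode n P i = trans (cong (Inverse.to 2↔Bool) (finToFun-funToFin (Inverse.from 2↔Bool ∘ P) i))
                            (Inverse.strictlyInverseˡ 2↔Bool (P i))

funToFin-cong : ∀ m {n} {f g : Fin m → Fin n} → (∀ i → f i ≡ g i) → funToFin f ≡ funToFin g
funToFin-cong zero    e = refl
funToFin-cong (suc m) e = cong₂ combine (e zero) (funToFin-cong m (e ∘ suc))

encode-decode : ∀ n t → encode n (decode n t) ≡ t
encode-decode n t =
  trans (funToFin-cong n (λ i → Inverse.strictlyInverseʳ 2↔Bool (finToFun {2} {n} t i)))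
        (funToFin-finToFin {n} {2} t)

encode-== : ∀ n P t → encode n P == t ≡ allFin n (λ i → P i ⇔ᵇ decode n t i)
encode-== n P t = bool-ext
  (λ e → allFin-intro n λ i →
     subst (λ z → P i ⇔ᵇ decode n z i ≡ true) (==-true e)
           (subst (λ z → P i ⇔ᵇ z ≡ true) (sym (decode-encode n P i)) (⇔ᵇ-refl (P i))))
  (λ e → subst (λ z → encode n P == z ≡ true)
               (trans (encode-cong (λ i → ⇔ᵇ-true _ _ (allFin-elim n e i))) (encode-decode n t))
               (==-refl (encode n P)))
  where
  encode-cong : ∀ {Q} → (∀ i → P i ≡ Q i) → encode n P ≡ encode n Q
  encode-cong e = funToFin-cong n (cong (Inverse.from 2↔Bool) ∘ e)

encode-image-== : ∀ M N (h : Fin M → Fin N) t →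
  encode N (image h) == t ≡ quantIn all N (decode N t) (image h) ∧ allFin M (decode N t ∘ h)
encode-image-== M N h t = trans (encode-== N (image h) t) (bool-ext to from)
  where
  dt = decode N t

  to : allFin N (λ s → image h s ⇔ᵇ dt s) ≡ true →
       quantIn all N dt (image h) ∧ allFin M (dt ∘ h) ≡ true
  to e = ∧-intro
    (allFin-intro N λ s → subst (λ z → not (dt s) ∨ z ≡ true) (sym (same s)) (∨-inverseˡ (dt s)))
    (allFin-intro M λ w → trans (sym (same (h w))) (anyFin-intro M w (==-refl (h w))))
    where
    same : ∀ s → image h s ≡ dt s
    same s = ⇔ᵇ-true _ _ (allFin-elim N e s)

  from : quantIn all N dt (image h) ∧ allFin M (dt ∘ h) ≡ true →
         allFin N (λ s → image h s ⇔ᵇ dt s) ≡ true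
  from e = allFin-intro N λ s → subst (λ z → image h s ⇔ᵇ z ≡ true) (same s) (⇔ᵇ-refl (image h s))
    where
    sub  = allFin-elim N (proj₁ (∧-elim (quantIn all N dt (image h)) e))
    hits = allFin-elim M (proj₂ (∧-elim (quantIn all N dt (image h)) e))
    same : ∀ s → image h s ≡ dt s
    same s = bool-ext (λ s∈h → let (w , hw==s) = anyFin-witness M s∈h in
                               subst (λ z → dt z ≡ true) (==-true hw==s) (hits w))
                      (λ s∈t → subst (λ z → not z ∨ image h s ≡ true) s∈t (sub s))

-- Types and evaluation of formulas on types

#types : ℕ → ℕ → ℕ
#types zero    j = 2 ^ (j * j)
#types (suc d) j = 2 ^ #types d (suc j)

Type : ℕ → ℕ → Set
Type d j = Fin (#types d j)

upd : {A : Set} → (ℕ → A) → ℕ → A → ℕ → A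
upd ρ x v y = if y ≡ᵇ x then v else ρ y

upd-here : ∀ {A : Set} (ρ : ℕ → A) x v → upd ρ x v x ≡ v
upd-here ρ x v rewrite ≡ᵇ-refl x = refl

upd-below : ∀ {A : Set} (ρ : ℕ → A) {j} v {a} → a < j → upd ρ j v a ≡ ρ a
upd-below ρ v a<j rewrite ≢⇒≡ᵇ-false (<⇒≢ a<j) = refl

-- A depth-0 type has one bit per ordered pair of positions (a, b): adjacency
-- for a < b, equality for b < a, and a false atom on the diagonal.
pairAtom : ℕ → ℕ → Formula
pairAtom a b = if a <ᵇ b then adjF a b else if b <ᵇ a then eqF b a else negF (eqF a a)

pairAt : (j : ℕ) → Fin (j * j) → Formula
pairAt j p = pairAtom (toℕ (proj₁ (remQuot {j} j p))) (toℕ (proj₂ (remQuot {j} j p)))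

readPair : (j : ℕ) → Type 0 j → ℕ → ℕ → Bool
readPair j t a b with a <? j | b <? j
... | yes a<j | yes b<j = decode (j * j) t (combine (fromℕ< a<j) (fromℕ< b<j))
... | _       | _       = false

readAdj readEq : (j : ℕ) → Type 0 j → ℕ → ℕ → Bool
readAdj j t a b = if a <ᵇ b then readPair j t a b else if b <ᵇ a then readPair j t b a else false
readEq  j t a b = if a <ᵇ b then readPair j t b a else if b <ᵇ a then readPair j t a b else true

-- Evaluates a property of a depth-0 type on a type of depth d by descending
-- through any realised extension; all extensions agree on the old positions.
descend : ((j : ℕ) → Type 0 j → Bool) → (d j : ℕ) → Type d j → Bool
descend r zero    j t = r j t
descend r (suc d) j t = quantIn ex (#types d (suc j)) (decode _ t) (descend r d (suc j))

-- σ sends each variable to the position of its value in the tuple; the variable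
-- bound by a quantifier over a type of j-tuples gets position j.  Quantifiers on
-- types of depth 0 are junk and never reached.
evalType : Formula → (ℕ → ℕ) → (d j : ℕ) → Type d j → Bool
evalType (adjF x y)   σ d       j   = descend (λ i t → readAdj i t (σ x) (σ y)) d j
evalType (eqF x y)    σ d       j   = descend (λ i t → readEq i t (σ x) (σ y)) d j
evalType (negF φ)     σ d       j t = not (evalType φ σ d j t)
evalType (binF o φ ψ) σ d       j t = evalOp o (evalType φ σ d j t) (evalType ψ σ d j t)
evalType (qF q x φ)   σ zero    j t = false
evalType (qF q x φ)   σ (suc d) j t = quantIn q _ (decode _ t) (evalType φ (upd σ x j) d (suc j))

atom-freeˡ : ∀ x y → free x (adjF x y) ≡ true
atom-freeˡ x y = ∨-introˡ _ (≡ᵇ-refl x)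

atom-freeʳ : ∀ x y → free y (adjF x y) ≡ true
atom-freeʳ x y = ∨-introʳ _ (≡ᵇ-refl y)

free-qF : ∀ q x φ {y} → (y ≡ᵇ x) ≡ false → free y φ ≡ true → free y (qF q x φ) ≡ true
free-qF q x φ {y} y≢x e = trans (cong (λ z → not z ∧ free y φ) y≢x) e

upd-agree : ∀ {A : Set} q x φ (ρ₁ ρ₂ : ℕ → A) v →
  (∀ y → free y (qF q x φ) ≡ true → ρ₁ y ≡ ρ₂ y) →
  ∀ y → free y φ ≡ true → upd ρ₁ x v y ≡ upd ρ₂ x v y
upd-agree q x φ ρ₁ ρ₂ v agree y e with y ≡ᵇ x in y≢x
... | true  = refl
... | false = agree y (free-qF q x φ y≢x e)

module _ (G : Graph) where
  open Graph G using (m; adj)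

  typeOf : (d j : ℕ) → (ℕ → Vertex G) → Type d j
  typeOf zero    j ρ = encode (j * j) (λ p → eval G ρ (pairAt j p))
  typeOf (suc d) j ρ = encode (#types d (suc j)) (image (λ w → typeOf d (suc j) (upd ρ j w)))

  readPair-typeOf : ∀ {j} ρ {a b} → a < j → b < j →
    readPair j (typeOf 0 j ρ) a b ≡ eval G ρ (pairAtom a b)
  readPair-typeOf {j} ρ {a} {b} a<j b<j with a <? j | b <? j
  ... | yes a<j' | yes b<j' = begin
      decode (j * j) (typeOf 0 j ρ) (combine (fromℕ< a<j') (fromℕ< b<j'))
    ≡⟨ decode-encode (j * j) _ _ ⟩
      eval G ρ (pairAt j (combine (fromℕ< a<j') (fromℕ< b<j')))
    ≡⟨ cong (λ r → eval G ρ (pairAtom (toℕ (proj₁ r)) (toℕ (proj₂ r)))) (remQuot-combine {j} {j} _ _) ⟩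
      eval G ρ (pairAtom (toℕ (fromℕ< a<j')) (toℕ (fromℕ< b<j')))
    ≡⟨ cong₂ (λ a b → eval G ρ (pairAtom a b)) (toℕ-fromℕ< a<j') (toℕ-fromℕ< b<j') ⟩
      eval G ρ (pairAtom a b) ∎
    where open ≡-Reasoning
  ... | no a≮j | _        = contradiction a<j a≮j
  ... | yes _  | no b≮j   = contradiction b<j b≮j

  readAdj-typeOf : ∀ {i} ρ a b → a < i → b < i → readAdj i (typeOf 0 i ρ) a b ≡ adj (ρ a) (ρ b)
  readAdj-typeOf ρ a b a<i b<i rewrite readPair-typeOf ρ a<i b<i | readPair-typeOf ρ b<i a<i
    with a <ᵇ b in a<b | b <ᵇ a in b<a
  ... | true  | _     = refl
  ... | false | true  = Graph.sym G (ρ b) (ρ a)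
  ... | false | false =
    subst (λ z → false ≡ adj (ρ a) (ρ z)) (≮ᵇ-both⇒≡ {a} {b} a<b b<a) (sym (Graph.irrefl G (ρ a)))

  readEq-typeOf : ∀ {i} ρ a b → a < i → b < i → readEq i (typeOf 0 i ρ) a b ≡ (ρ a == ρ b)
  readEq-typeOf ρ a b a<i b<i rewrite readPair-typeOf ρ a<i b<i | readPair-typeOf ρ b<i a<i
    with a <ᵇ b in a<b | b <ᵇ a in b<a
  ... | true  | true  = contradiction (<ᵇ-true⇒< {a} a<b) (<⇒≯ (<ᵇ-true⇒< {b} b<a))
  ... | true  | false = refl
  ... | false | true  = ==-sym (ρ b) (ρ a)
  ... | false | false =
    subst (λ z → true ≡ (ρ a == ρ z)) (≮ᵇ-both⇒≡ {a} {b} a<b b<a) (sym (==-refl (ρ a)))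

  descend-typeOf : ∀ r (Q : Vertex G → Vertex G → Bool) {a b} →
    (∀ i ρ → a < i → b < i → r i (typeOf 0 i ρ) ≡ Q (ρ a) (ρ b)) →
    ∀ d j ρ → a < j → b < j → descend r d j (typeOf d j ρ) ≡ Q (ρ a) (ρ b)
  descend-typeOf r Q base zero    j ρ a<j b<j = base j ρ a<j b<j
  descend-typeOf r Q {a} {b} base (suc d) j ρ a<j b<j = begin
      quantIn ex A (decode A (encode A (image h))) (descend r d (suc j))
    ≡⟨ quantIn-cong ex A (decode-encode A (image h)) (λ _ → refl) ⟩
      quantIn ex A (image h) (descend r d (suc j))
    ≡⟨ sym (anyFin-image (suc m) h _) ⟩
      anyFin (suc m) (λ w → descend r d (suc j) (h w))
    ≡⟨ anyFin-cong (suc m) (λ w → trans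
         (descend-typeOf r Q base d (suc j) (upd ρ j w) (m<n⇒m<1+n a<j) (m<n⇒m<1+n b<j))
         (cong₂ Q (upd-below ρ w a<j) (upd-below ρ w b<j))) ⟩
      anyFin (suc m) (λ _ → Q (ρ a) (ρ b))
    ≡⟨ anyFin-const m _ ⟩
      Q (ρ a) (ρ b) ∎
    where
    open ≡-Reasoning
    A = #types d (suc j)
    h = λ w → typeOf d (suc j) (upd ρ j w)

  eval-qF : ∀ q x φ ρ → eval G ρ (qF q x φ) ≡ quant q (suc m) (λ v → eval G (upd ρ x v) φ)
  eval-qF ex  x φ ρ = refl
  eval-qF all x φ ρ = refl

  eval-cong-free : ∀ φ (ρ₁ ρ₂ : ℕ → Vertex G) → (∀ y → free y φ ≡ true → ρ₁ y ≡ ρ₂ y) →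
    eval G ρ₁ φ ≡ eval G ρ₂ φ
  eval-cong-free (adjF x y) ρ₁ ρ₂ agree =
    cong₂ adj (agree x (atom-freeˡ x y)) (agree y (atom-freeʳ x y))
  eval-cong-free (eqF x y) ρ₁ ρ₂ agree =
    cong₂ _==_ (agree x (atom-freeˡ x y)) (agree y (atom-freeʳ x y))
  eval-cong-free (negF φ) ρ₁ ρ₂ agree = cong not (eval-cong-free φ ρ₁ ρ₂ agree)
  eval-cong-free (binF o φ ψ) ρ₁ ρ₂ agree = cong₂ (evalOp o)
    (eval-cong-free φ ρ₁ ρ₂ (λ y e → agree y (∨-introˡ _ e)))
    (eval-cong-free ψ ρ₁ ρ₂ (λ y e → agree y (∨-introʳ (free y φ) e)))
  eval-cong-free (qF q x φ) ρ₁ ρ₂ agree = begin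
      eval G ρ₁ (qF q x φ)
    ≡⟨ eval-qF q x φ ρ₁ ⟩
      quant q (suc m) (λ v → eval G (upd ρ₁ x v) φ)
    ≡⟨ quant-cong q (suc m) (λ v → eval-cong-free φ _ _ (upd-agree q x φ ρ₁ ρ₂ v agree)) ⟩
      quant q (suc m) (λ v → eval G (upd ρ₂ x v) φ)
    ≡⟨ sym (eval-qF q x φ ρ₂) ⟩
      eval G ρ₂ (qF q x φ) ∎
    where open ≡-Reasoning

  evalType-typeOf : ∀ φ d j σ ρ → qd φ ≤ d → (∀ y → free y φ ≡ true → σ y < j) →
    eval G (ρ ∘ σ) φ ≡ evalType φ σ d j (typeOf d j ρ)
  evalType-typeOf (adjF x y) d j σ ρ _ below = sym (descend-typeOf (λ i t → readAdj i t (σ x) (σ y)) adj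
    (λ i ρ' → readAdj-typeOf ρ' (σ x) (σ y)) d j ρ (below x (atom-freeˡ x y)) (below y (atom-freeʳ x y)))
  evalType-typeOf (eqF x y) d j σ ρ _ below = sym (descend-typeOf (λ i t → readEq i t (σ x) (σ y)) _==_
    (λ i ρ' → readEq-typeOf ρ' (σ x) (σ y)) d j ρ (below x (atom-freeˡ x y)) (below y (atom-freeʳ x y)))
  evalType-typeOf (negF φ) d j σ ρ φ≤d below = cong not (evalType-typeOf φ d j σ ρ φ≤d below)
  evalType-typeOf (binF o φ ψ) d j σ ρ φψ≤d below = cong₂ (evalOp o)
    (evalType-typeOf φ d j σ ρ (m⊔n≤o⇒m≤o (qd φ) (qd ψ) φψ≤d) (λ y e → below y (∨-introˡ _ e)))
    (evalType-typeOf ψ d j σ ρ (m⊔n≤o⇒n≤o (qd φ) (qd ψ) φψ≤d)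
                     (λ y e → below y (∨-introʳ (free y φ) e)))
  evalType-typeOf (qF q x φ) (suc d) j σ ρ (s≤s φ≤d) below = begin
      eval G (ρ ∘ σ) (qF q x φ)
    ≡⟨ eval-qF q x φ (ρ ∘ σ) ⟩
      quant q (suc m) (λ v → eval G (upd (ρ ∘ σ) x v) φ)
    ≡⟨ quant-cong q (suc m) (λ v → trans (eval-cong-free φ _ _ (shift v))
                                          (evalType-typeOf φ d (suc j) σ' (upd ρ j v) φ≤d below')) ⟩
      quant q (suc m) (F ∘ h)
    ≡⟨ quant-image q (suc m) h F ⟩
      quantIn q A (image h) F
    ≡⟨ quantIn-cong q A (λ s → sym (decode-encode A (image h) s)) (λ _ → refl) ⟩
      quantIn q A (decode A (typeOf (suc d) j ρ)) F ∎
    where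
    open ≡-Reasoning
    A  = #types d (suc j)
    σ' = upd σ x j
    h  = λ w → typeOf d (suc j) (upd ρ j w)
    F  = evalType φ σ' d (suc j)

    below' : ∀ y → free y φ ≡ true → σ' y < suc j
    below' y e with y ≡ᵇ x in y≢x
    ... | true  = n<1+n j
    ... | false = m<n⇒m<1+n (below y (free-qF q x φ y≢x e))

    shift : ∀ v y → free y φ ≡ true → upd (ρ ∘ σ) x v y ≡ upd ρ j v (σ' y)
    shift v y e with y ≡ᵇ x in y≢x
    ... | true  = sym (upd-here ρ j v)
    ... | false = sym (upd-below ρ v (below y (free-qF q x φ y≢x e)))

-- Hintikka formulas

bigOp : BinOp → (n : ℕ) → (Fin n → Bool) → (Fin n → Formula) → Formula → Formula
bigOp o zero    P φ z = z
bigOp o (suc n) P φ z = if P zero then binF o (φ zero) rest else rest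
  where rest = bigOp o n (P ∘ suc) (φ ∘ suc) z

signed : Bool → Formula → Formula
signed true  φ = φ
signed false φ = negF φ

-- eqF 0 0 and negF (eqF j j) stand for truth and falsity when nothing is selected.
hintikka : (d j : ℕ) → Type d j → Formula
hintikka zero    j t = bigOp and (j * j) (λ _ → true) (λ p → signed (decode (j * j) t p) (pairAt j p)) (eqF 0 0)
hintikka (suc d) j t =
  bigOp and A (decode A t) (λ s → qF ex j (hintikka d (suc j) s))
    (qF all j (bigOp or A (decode A t) (hintikka d (suc j)) (negF (eqF j j))))
  where A = #types d (suc j)

module _ (G : Graph) where
  open Graph G using (m)

  eval-bigAnd : ∀ ρ n P φ z →
    eval G ρ (bigOp and n P φ z) ≡ quantIn all n P (λ i → eval G ρ (φ i)) ∧ eval G ρ z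
  eval-bigAnd ρ zero    P φ z = refl
  eval-bigAnd ρ (suc n) P φ z with P zero
  ... | true  = trans (cong (eval G ρ (φ zero) ∧_) (eval-bigAnd ρ n (P ∘ suc) (φ ∘ suc) z))
                      (sym (∧-assoc (eval G ρ (φ zero)) _ _))
  ... | false = eval-bigAnd ρ n (P ∘ suc) (φ ∘ suc) z

  eval-bigOr : ∀ ρ n P φ z →
    eval G ρ (bigOp or n P φ z) ≡ quantIn ex n P (λ i → eval G ρ (φ i)) ∨ eval G ρ z
  eval-bigOr ρ zero    P φ z = refl
  eval-bigOr ρ (suc n) P φ z with P zero
  ... | true  = trans (cong (eval G ρ (φ zero) ∨_) (eval-bigOr ρ n (P ∘ suc) (φ ∘ suc) z))
                      (sym (∨-assoc (eval G ρ (φ zero)) _ _))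
  ... | false = eval-bigOr ρ n (P ∘ suc) (φ ∘ suc) z

  eval-signed : ∀ ρ b φ → eval G ρ (signed b φ) ≡ eval G ρ φ ⇔ᵇ b
  eval-signed ρ true  φ with eval G ρ φ
  ... | true  = refl
  ... | false = refl
  eval-signed ρ false φ with eval G ρ φ
  ... | true  = refl
  ... | false = refl

  eval-hintikka : ∀ d j ρ t → eval G ρ (hintikka d j t) ≡ typeOf G d j ρ == t
  eval-hintikka zero j ρ t = begin
      eval G ρ (hintikka zero j t)
    ≡⟨ eval-bigAnd ρ (j * j) _ _ (eqF 0 0) ⟩
      allFin (j * j) (λ p → eval G ρ (signed (decode (j * j) t p) (pairAt j p))) ∧ (ρ 0 == ρ 0)
    ≡⟨ cong₂ _∧_ (allFin-cong (j * j) (λ p → eval-signed ρ _ (pairAt j p))) (==-refl (ρ 0)) ⟩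
      allFin (j * j) (λ p → eval G ρ (pairAt j p) ⇔ᵇ decode (j * j) t p) ∧ true
    ≡⟨ ∧-identityʳ _ ⟩
      allFin (j * j) (λ p → eval G ρ (pairAt j p) ⇔ᵇ decode (j * j) t p)
    ≡⟨ sym (encode-== (j * j) _ t) ⟩
      typeOf G zero j ρ == t ∎
    where open ≡-Reasoning
  eval-hintikka (suc d) j ρ t = begin
      eval G ρ (hintikka (suc d) j t)
    ≡⟨ eval-bigAnd ρ A dt (λ s → qF ex j (hintikka d (suc j) s)) _ ⟩
      quantIn all A dt (λ s → anyFin (suc m) (λ w → eval G (upd ρ j w) (hintikka d (suc j) s)))
        ∧ allFin (suc m) (λ w → eval G (upd ρ j w) (bigOp or A dt (hintikka d (suc j)) (negF (eqF j j))))
    ≡⟨ cong₂ _∧_ (quantIn-cong all A {dt} (λ _ → refl) extended) (allFin-cong (suc m) realised) ⟩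
      quantIn all A dt (image h) ∧ allFin (suc m) (dt ∘ h)
    ≡⟨ sym (encode-image-== (suc m) A h t) ⟩
      typeOf G (suc d) j ρ == t ∎
    where
    open ≡-Reasoning
    A  = #types d (suc j)
    dt = decode A t
    h  = λ w → typeOf G d (suc j) (upd ρ j w)

    extended : ∀ s → anyFin (suc m) (λ w → eval G (upd ρ j w) (hintikka d (suc j) s)) ≡ image h s
    extended s = anyFin-cong (suc m) λ w → eval-hintikka d (suc j) (upd ρ j w) s

    realised : ∀ w → eval G (upd ρ j w) (bigOp or A dt (hintikka d (suc j)) (negF (eqF j j))) ≡ dt (h w)
    realised w = begin
        eval G ρ' (bigOp or A dt (hintikka d (suc j)) (negF (eqF j j)))
      ≡⟨ eval-bigOr ρ' A dt (hintikka d (suc j)) (negF (eqF j j)) ⟩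
        quantIn ex A dt (λ s → eval G ρ' (hintikka d (suc j) s)) ∨ not (ρ' j == ρ' j)
      ≡⟨ cong₂ _∨_ (quantIn-cong ex A {dt} (λ _ → refl) (eval-hintikka d (suc j) ρ')) (cong not (==-refl (ρ' j))) ⟩
        quantIn ex A dt (h w ==_) ∨ false
      ≡⟨ ∨-identityʳ _ ⟩
        quantIn ex A dt (h w ==_)
      ≡⟨ quantIn-ex-== A dt (h w) ⟩
        dt (h w) ∎
      where ρ' = upd ρ j w

qd-bigOp≤ : ∀ {D} o n P φ z → (∀ i → qd (φ i) ≤ D) → qd z ≤ D → qd (bigOp o n P φ z) ≤ D
qd-bigOp≤ o zero    P φ z _ z≤D = z≤D
qd-bigOp≤ o (suc n) P φ z φ≤D z≤D with P zero
... | true  = ⊔-lub (φ≤D zero) (qd-bigOp≤ o n (P ∘ suc) (φ ∘ suc) z (φ≤D ∘ suc) z≤D)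
... | false = qd-bigOp≤ o n (P ∘ suc) (φ ∘ suc) z (φ≤D ∘ suc) z≤D

qd-bigOp≡ : ∀ o n P φ z → (∀ i → qd (φ i) ≤ qd z) → qd (bigOp o n P φ z) ≡ qd z
qd-bigOp≡ o zero    P φ z _ = refl
qd-bigOp≡ o (suc n) P φ z φ≤z with P zero
... | true  = trans (cong (qd (φ zero) ⊔_) (qd-bigOp≡ o n (P ∘ suc) (φ ∘ suc) z (φ≤z ∘ suc)))
                    (m≤n⇒m⊔n≡n (φ≤z zero))
... | false = qd-bigOp≡ o n (P ∘ suc) (φ ∘ suc) z (φ≤z ∘ suc)

free-bigOp : ∀ o n P φ z y → (∀ i → free y (φ i) ≡ false) → free y z ≡ false →
  free y (bigOp o n P φ z) ≡ false
free-bigOp o zero    P φ z y _ z-closed = z-closed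
free-bigOp o (suc n) P φ z y φ-closed z-closed with P zero
... | true  rewrite φ-closed zero = free-bigOp o n (P ∘ suc) (φ ∘ suc) z y (φ-closed ∘ suc) z-closed
... | false = free-bigOp o n (P ∘ suc) (φ ∘ suc) z y (φ-closed ∘ suc) z-closed

len-bigOp : ∀ B o n P φ z → (∀ i → len (φ i) ≤ B) → len (bigOp o n P φ z) ≤ n * (B + 3) + len z
len-bigOp B o zero    P φ z _ = ≤-refl
len-bigOp B o (suc n) P φ z φ≤B with P zero
... | true  = begin
      3 + len (φ zero) + len rest
    ≤⟨ +-mono-≤ (+-monoʳ-≤ 3 (φ≤B zero)) rest≤ ⟩
      3 + B + (n * (B + 3) + len z)
    ≡⟨ cong (_+ (n * (B + 3) + len z)) (+-comm 3 B) ⟩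
      B + 3 + (n * (B + 3) + len z)
    ≡⟨ sym (+-assoc (B + 3) _ (len z)) ⟩
      suc n * (B + 3) + len z ∎
  where
  open ≤-Reasoning
  rest = bigOp o n (P ∘ suc) (φ ∘ suc) z
  rest≤ = len-bigOp B o n (P ∘ suc) (φ ∘ suc) z (φ≤B ∘ suc)
... | false = ≤-trans (len-bigOp B o n (P ∘ suc) (φ ∘ suc) z (φ≤B ∘ suc))
                      (+-monoˡ-≤ (len z) (m≤n+m (n * (B + 3)) (B + 3)))

qd-signed : ∀ b φ → qd (signed b φ) ≡ qd φ
qd-signed true  φ = refl
qd-signed false φ = refl

free-signed : ∀ b φ y → free y (signed b φ) ≡ free y φ
free-signed true  φ y = refl
free-signed false φ y = refl

len-signed : ∀ b φ → len (signed b φ) ≤ suc (len φ)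
len-signed true  φ = n≤1+n (len φ)
len-signed false φ = ≤-refl

qd-pairAtom : ∀ a b → qd (pairAtom a b) ≡ 0
qd-pairAtom a b with a <ᵇ b | b <ᵇ a
... | true  | _     = refl
... | false | true  = refl
... | false | false = refl

len-pairAtom : ∀ a b → len (pairAtom a b) ≤ 4
len-pairAtom a b with a <ᵇ b | b <ᵇ a
... | true  | _     = n≤1+n 3
... | false | true  = n≤1+n 3
... | false | false = ≤-refl

free-pairAtom : ∀ {a b y} → a < y → b < y → free y (pairAtom a b) ≡ false
free-pairAtom {a} {b} a<y b<y with a <ᵇ b | b <ᵇ a
... | true  | _     = cong₂ _∨_ (>⇒≡ᵇ-false a<y) (>⇒≡ᵇ-false b<y)
... | false | true  = cong₂ _∨_ (>⇒≡ᵇ-false b<y) (>⇒≡ᵇ-false a<y)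
... | false | false = cong₂ _∨_ (>⇒≡ᵇ-false a<y) (>⇒≡ᵇ-false a<y)

qd-pairAt : ∀ j p → qd (pairAt j p) ≡ 0
qd-pairAt j p = qd-pairAtom (toℕ (proj₁ (remQuot {j} j p))) (toℕ (proj₂ (remQuot {j} j p)))

len-pairAt : ∀ j p → len (pairAt j p) ≤ 4
len-pairAt j p = len-pairAtom (toℕ (proj₁ (remQuot {j} j p))) (toℕ (proj₂ (remQuot {j} j p)))

free-pairAt : ∀ j p {y} → j ≤ y → free y (pairAt j p) ≡ false
free-pairAt j p j≤y = free-pairAtom {toℕ (proj₁ (remQuot {j} j p))} {toℕ (proj₂ (remQuot {j} j p))}
  (<-≤-trans (toℕ<n _) j≤y) (<-≤-trans (toℕ<n _) j≤y)

free-qF-bound : ∀ q x φ {y} → x ≤ y → (x < y → free y φ ≡ false) → free y (qF q x φ) ≡ false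
free-qF-bound q x φ {y} x≤y φ-closed with y ≡ᵇ x in y≢x
... | true  = refl
... | false = φ-closed (≤∧≢⇒< x≤y (≢-sym (≡ᵇ-false⇒≢ y≢x)))

qd-hintikka : ∀ d j t → qd (hintikka d j t) ≤ d
qd-hintikka zero    j t = qd-bigOp≤ and (j * j) _ _ (eqF 0 0)
  (λ p → ≤-reflexive (trans (qd-signed (decode (j * j) t p) (pairAt j p)) (qd-pairAt j p))) z≤n
qd-hintikka (suc d) j t = qd-bigOp≤ and A _ _ _ (λ s → s≤s (qd-hintikka d (suc j) s))
  (s≤s (qd-bigOp≤ or A _ _ _ (qd-hintikka d (suc j)) z≤n))
  where A = #types d (suc j)

-- The hypothesis 0 < d + j excludes hintikka 0 0 t = eqF 0 0.
free-hintikka : ∀ d j t y → 0 < d + j → j ≤ y → free y (hintikka d j t) ≡ false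
free-hintikka zero j t y 0<j j≤y = free-bigOp and (j * j) _ _ (eqF 0 0) y
  (λ p → trans (free-signed (decode (j * j) t p) (pairAt j p) y) (free-pairAt j p j≤y))
  (cong₂ _∨_ (>⇒≡ᵇ-false (<-≤-trans 0<j j≤y)) (>⇒≡ᵇ-false (<-≤-trans 0<j j≤y)))
free-hintikka (suc d) j t y _ j≤y = free-bigOp and A _ _ _ y
  (λ s → free-qF-bound ex j (hintikka d (suc j) s) j≤y (λ j<y → free-hintikka d (suc j) s y 0<d+1+j j<y))
  (free-qF-bound all j (bigOp or A (decode A t) (hintikka d (suc j)) (negF (eqF j j))) j≤y
     (λ j<y → free-bigOp or A _ _ _ y (λ s → free-hintikka d (suc j) s y 0<d+1+j j<y)
                                (cong₂ _∨_ (>⇒≡ᵇ-false j<y) (>⇒≡ᵇ-false j<y))))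
  where
  A = #types d (suc j)
  0<d+1+j = subst (0 <_) (sym (+-suc d j)) z<s

stepLength : ℕ → ℕ → ℕ
stepLength A L = A * ((2 + L) + 3) + (2 + (A * (L + 3) + 4))

hintikkaLength : ℕ → ℕ → ℕ
hintikkaLength zero    j = (j * j) * 8 + 3
hintikkaLength (suc d) j = stepLength (#types d (suc j)) (hintikkaLength d (suc j))

len-hintikka : ∀ d j t → len (hintikka d j t) ≤ hintikkaLength d j
len-hintikka zero    j t = len-bigOp 5 and (j * j) _ _ (eqF 0 0)
  (λ p → ≤-trans (len-signed (decode (j * j) t p) (pairAt j p)) (s≤s (len-pairAt j p)))
len-hintikka (suc d) j t = ≤-trans
  (len-bigOp (2 + L) and A _ _ _ (λ s → +-monoʳ-≤ 2 (len-hintikka d (suc j) s)))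
  (+-monoʳ-≤ (A * ((2 + L) + 3)) (+-monoʳ-≤ 2 (len-bigOp L or A _ _ (negF (eqF j j)) (len-hintikka d (suc j)))))
  where
  A = #types d (suc j)
  L = hintikkaLength d (suc j)

-- Pads the normal form to depth exactly k; a sentence only when n > 0.
falsum : ℕ → Formula
falsum zero    = negF (eqF 0 0)
falsum (suc n) = qF ex 0 (falsum n)

qd-falsum : ∀ n → qd (falsum n) ≡ n
qd-falsum zero    = refl
qd-falsum (suc n) = cong suc (qd-falsum n)

len-falsum : ∀ n → len (falsum n) ≡ 4 + (n + n)
len-falsum zero    = refl
len-falsum (suc n) = trans (cong (2 +_) (len-falsum n)) (cong (5 +_) (sym (+-suc n n)))

free-falsum : ∀ n y → free y (falsum (suc n)) ≡ false
free-falsum n zero    = refl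
free-falsum n (suc y) = positive n
  where
  positive : ∀ n → free (suc y) (falsum n) ≡ false
  positive zero    = refl
  positive (suc n) = positive n

eval-falsum : ∀ G ρ n → eval G ρ (falsum n) ≡ false
eval-falsum G ρ zero    = cong not (==-refl (ρ 0))
eval-falsum G ρ (suc n) = trans (anyFin-cong (suc (Graph.m G)) (λ v → eval-falsum G (upd ρ 0 v) n))
                                (anyFin-const (Graph.m G) false)

truthTable : Formula → (k : ℕ) → Type k 0 → Bool
truthTable Φ k = evalType Φ (λ _ → 0) k 0

emptyType : (G : Graph) (k : ℕ) → Type k 0
emptyType G k = typeOf G k 0 (λ _ → zero)

holds-truthTable : ∀ G Φ k → IsSentence Φ → qd Φ ≤ k → holds G Φ ≡ truthTable Φ k (emptyType G k)
holds-truthTable G Φ k closed Φ≤k =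
  evalType-typeOf G Φ k 0 (λ _ → 0) (λ _ → zero) Φ≤k
    (λ y y-free → contradiction (trans (sym y-free) (closed y)) λ ())

inequivalent-sentences-≤ : ∀ k n (φs : Fin n → Formula) →
  (∀ i → IsSentence (φs i) × qd (φs i) ≡ k) → (∀ i j → i ≢ j → ¬ Equivalent (φs i) (φs j)) →
  n ≤ 2 ^ #types k 0
inequivalent-sentences-≤ k n φs sentences distinct = injective⇒≤ injective
  where
  K = #types k 0

  holds≡table : ∀ G i → holds G (φs i) ≡ decode K (encode K (truthTable (φs i) k)) (emptyType G k)
  holds≡table G i =
    trans (holds-truthTable G (φs i) k (proj₁ (sentences i)) (≤-reflexive (proj₂ (sentences i))))
          (sym (decode-encode K _ _))

  injective : ∀ {i j} → encode K (truthTable (φs i) k) ≡ encode K (truthTable (φs j) k) → i ≡ j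
  injective {i} {j} same with i Fin.≟ j
  ... | yes i≡j = i≡j
  ... | no  i≢j = contradiction (λ G → trans (holds≡table G i)
                                 (trans (cong (λ c → decode K c (emptyType G k)) same) (sym (holds≡table G j))))
                                (distinct i j i≢j)

normalForm : ℕ → Formula → Formula
normalForm k Φ = bigOp or (#types k 0) (truthTable Φ k) (hintikka k 0) (falsum k)

normalForm-isSentence : ∀ k Φ → 1 ≤ k → IsSentence (normalForm k Φ)
normalForm-isSentence (suc k) Φ _ y =
  free-bigOp or _ _ _ _ y (λ t → free-hintikka (suc k) 0 t y z<s z≤n) (free-falsum k y)

normalForm-qd : ∀ k Φ → qd (normalForm k Φ) ≡ k
normalForm-qd k Φ = trans
  (qd-bigOp≡ or _ _ _ _ (λ t → subst (qd (hintikka k 0 t) ≤_) (sym (qd-falsum k)) (qd-hintikka k 0 t)))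
  (qd-falsum k)

normalForm-equivalent : ∀ k Φ → IsSentence Φ → qd Φ ≤ k → Equivalent Φ (normalForm k Φ)
normalForm-equivalent k Φ closed Φ≤k G = begin
    holds G Φ
  ≡⟨ holds-truthTable G Φ k closed Φ≤k ⟩
    table x
  ≡⟨ sym (quantIn-ex-== K table x) ⟩
    quantIn ex K table (x ==_)
  ≡⟨ sym (∨-identityʳ _) ⟩
    quantIn ex K table (x ==_) ∨ false
  ≡⟨ sym (cong₂ _∨_ (quantIn-cong ex K {table} (λ _ → refl) (eval-hintikka G k 0 ρ₀))
                    (eval-falsum G ρ₀ k)) ⟩
    quantIn ex K table (λ t → eval G ρ₀ (hintikka k 0 t)) ∨ eval G ρ₀ (falsum k)
  ≡⟨ sym (eval-bigOr G ρ₀ K table (hintikka k 0) (falsum k)) ⟩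
    holds G (normalForm k Φ) ∎
  where
  open ≡-Reasoning
  K = #types k 0
  table = truthTable Φ k
  ρ₀ = λ (_ : ℕ) → zero {Graph.m G}
  x = emptyType G k

len-normalForm : ∀ k Φ → len (normalForm k Φ) ≤ #types k 0 * (hintikkaLength k 0 + 3) + (4 + (k + k))
len-normalForm k Φ =
  subst (len (normalForm k Φ) ≤_) (cong (#types k 0 * (hintikkaLength k 0 + 3) +_) (len-falsum k))
        (len-bigOp (hintikkaLength k 0) or _ _ _ (falsum k) (len-hintikka k 0))

-- Size estimates

n<2^n : ∀ n → n < 2 ^ n
n<2^n zero    = z<s
n<2^n (suc n) = ≤-trans (≤-reflexive (+-comm 1 (suc n)))
                        (+-mono-≤ (n<2^n n) (≤-trans (m^n>0 2 n) (m≤m+n (2 ^ n) 0)))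

doubling⇒≤*2^ : ∀ (f : ℕ → ℕ) c n₀ → (∀ n → n₀ ≤ n → f (suc n) ≤ 2 * f n) →
  f n₀ ≤ c * 2 ^ n₀ → ∀ n → n₀ ≤ n → f n ≤ c * 2 ^ n
doubling⇒≤*2^ f c n₀ doubling base n n₀≤n = go (≤⇒≤′ n₀≤n)
  where
  open ≤-Reasoning
  go : ∀ {n} → n₀ ≤′ n → f n ≤ c * 2 ^ n
  go ≤′-refl = base
  go (≤′-step {n} n₀≤′n) = begin
      f (suc n)       ≤⟨ doubling n (≤′⇒≤ n₀≤′n) ⟩
      2 * f n         ≤⟨ *-monoʳ-≤ 2 (go n₀≤′n) ⟩
      2 * (c * 2 ^ n) ≡⟨ x∙yz≈y∙xz 2 c (2 ^ n) ⟩
      c * 2 ^ suc n   ∎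

square-doubling : ∀ n → 3 ≤ n → suc n * suc n ≤ 2 * (n * n)
square-doubling n 3≤n = begin
    suc n * suc n       ≡⟨ expand n ⟩
    n * n + (2 * n + 1) ≤⟨ +-monoʳ-≤ (n * n) 2n+1≤n² ⟩
    n * n + n * n       ≡⟨ cong (n * n +_) (sym (+-identityʳ (n * n))) ⟩
    2 * (n * n)         ∎
  where
  open ≤-Reasoning
  expand : ∀ n → suc n * suc n ≡ n * n + (2 * n + 1)
  expand = solve-∀
  2n+1≤n² : 2 * n + 1 ≤ n * n
  2n+1≤n² = begin
    2 * n + 1 ≤⟨ +-monoʳ-≤ (2 * n) (≤-trans (s≤s z≤n) 3≤n) ⟩
    2 * n + n ≡⟨ +-comm (2 * n) n ⟩
    3 * n     ≤⟨ *-monoˡ-≤ n 3≤n ⟩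
    n * n     ∎

n²≤2^n : ∀ n → 4 ≤ n → n * n ≤ 2 ^ n
n²≤2^n n 4≤n = ≤-trans
  (doubling⇒≤*2^ (λ n → n * n) 1 4 (λ n 4≤n → square-doubling n (≤-trans (n≤1+n 3) 4≤n))
                  ≤-refl n 4≤n)
  (≤-reflexive (*-identityˡ (2 ^ n)))

8n²≤2^n : ∀ n → 16 ≤ n → 8 * (n * n) ≤ 2 ^ n
8n²≤2^n n 16≤n = ≤-trans
  (doubling⇒≤*2^ (λ n → 8 * (n * n)) 1 16
     (λ n 16≤n → ≤-trans (*-monoʳ-≤ 8 (square-doubling n (≤-trans (≤ᵇ⇒≤ 3 16 tt) 16≤n)))
                         (≤-reflexive (x∙yz≈y∙xz 8 2 (n * n))))
     (≤ᵇ⇒≤ _ _ tt) n 16≤n)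
  (≤-reflexive (*-identityˡ (2 ^ n)))

8n+11≤4*2^n : ∀ n → 4 ≤ n → n * 8 + 3 + 8 ≤ 4 * 2 ^ n
8n+11≤4*2^n = doubling⇒≤*2^ (λ n → n * 8 + 3 + 8) 4 4
  (λ n _ → ≤-trans (m≤m+n _ (n * 8 + 3)) (≤-reflexive (double n))) (≤ᵇ⇒≤ _ _ tt)
  where
  double : ∀ n → suc n * 8 + 3 + 8 + (n * 8 + 3) ≡ 2 * (n * 8 + 3 + 8)
  double = solve-∀

Tower>0 : ∀ l → 0 < Tower l
Tower>0 zero    = ≤-refl
Tower>0 (suc l) = m^n>0 2 (Tower l)

Tower²≤2^Tower : ∀ l → Tower l * Tower l ≤ 2 ^ Tower l
Tower²≤2^Tower zero          = n≤1+n 1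
Tower²≤2^Tower (suc zero)    = ≤-refl
Tower²≤2^Tower (suc (suc l)) = n²≤2^n _ (^-monoʳ-≤ 2 (^-monoʳ-≤ 2 (Tower>0 l)))

#types-≤-Tower : ∀ l d j → j + d ≤ Tower l → #types d j ≤ Tower (d + l + 2)
#types-≤-Tower l zero    j j≤T = subst (λ i → 2 ^ (j * j) ≤ Tower i) (+-comm 2 l)
  (^-monoʳ-≤ 2 (≤-trans (*-mono-≤ j≤Tower j≤Tower) (Tower²≤2^Tower l)))
  where j≤Tower = ≤-trans (m≤m+n j 0) j≤T
#types-≤-Tower l (suc d) j j+d≤T =
  ^-monoʳ-≤ 2 (#types-≤-Tower l d (suc j) (≤-trans (≤-reflexive (sym (+-suc j d))) j+d≤T))

2^j≤#types : ∀ d j → 2 ^ j ≤ #types d j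
2^j≤#types zero    zero    = ≤-refl
2^j≤#types zero    (suc j) = ^-monoʳ-≤ 2 (m≤m*n (suc j) (suc j))
2^j≤#types (suc d) j       =
  ^-monoʳ-≤ 2 (<⇒≤ (<-trans (n<1+n j) (<-≤-trans (n<2^n (suc j)) (2^j≤#types d (suc j)))))

16≤#types : ∀ d j → 16 ≤ #types (suc d) (suc j)
16≤#types d j =
  ^-monoʳ-≤ 2 (≤-trans (^-monoʳ-≤ 2 (s≤s (s≤s (z≤n {j})))) (2^j≤#types d (suc (suc j))))

d≤#types : ∀ d j → d ≤ #types d j
d≤#types zero    j = z≤n
d≤#types (suc d) j = ≤-trans (s≤s (d≤#types d (suc j))) (n<2^n (#types d (suc j)))

stepLength-bound : ∀ A L → 16 ≤ A → L + 8 ≤ 4 * A → stepLength A L + 8 ≤ 2 ^ A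
stepLength-bound A L 16≤A L+8≤4A = begin
    stepLength A L + 8                ≡⟨ expand A L ⟩
    2 * (A * L) + 8 * A + 14          ≤⟨ +-monoʳ-≤ (2 * (A * L) + 8 * A) 14≤8A ⟩
    2 * (A * L) + 8 * A + 8 * A       ≡⟨ factor A L ⟩
    2 * (A * (L + 8))                 ≤⟨ *-monoʳ-≤ 2 (*-monoʳ-≤ A L+8≤4A) ⟩
    2 * (A * (4 * A))                 ≡⟨ square A ⟩
    8 * (A * A)                       ≤⟨ 8n²≤2^n A 16≤A ⟩
    2 ^ A                             ∎
  where
  open ≤-Reasoning
  expand : ∀ A L → A * ((2 + L) + 3) + (2 + (A * (L + 3) + 4)) + 8 ≡ 2 * (A * L) + 8 * A + 14
  expand = solve-∀
  factor : ∀ A L → 2 * (A * L) + 8 * A + 8 * A ≡ 2 * (A * (L + 8))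
  factor = solve-∀
  square : ∀ A → 2 * (A * (4 * A)) ≡ 8 * (A * A)
  square = solve-∀
  14≤8A = ≤-trans (≤ᵇ⇒≤ 14 128 tt) (*-monoʳ-≤ 8 16≤A)

hintikkaLength-bound : ∀ d j → 0 < d + j → hintikkaLength (suc d) j + 8 ≤ #types (suc d) j
hintikkaLength-bound zero    (suc j) _ =
  stepLength-bound (2 ^ a) (a * 8 + 3) (^-monoʳ-≤ 2 4≤a) (8n+11≤4*2^n a 4≤a)
  where
  a = suc (suc j) * suc (suc j)
  4≤a = *-mono-≤ {2} {suc (suc j)} {2} {suc (suc j)} (s≤s (s≤s z≤n)) (s≤s (s≤s z≤n))
hintikkaLength-bound (suc d) j _ = stepLength-bound _ _ (16≤#types d j)
  (≤-trans (hintikkaLength-bound d (suc j) (subst (0 <_) (sym (+-suc d j)) z<s)) (m≤n*m _ 4))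

A*[L+3]+[4+2k]<T*T : ∀ {A L T k} → 16 ≤ A → k ≤ A → L + 8 ≤ A → A ≤ T →
  A * (L + 3) + (4 + (k + k)) < T * T
A*[L+3]+[4+2k]<T*T {A} {L} {T} {k} 16≤A k≤A L+8≤A A≤T = begin-strict
    A * (L + 3) + (4 + (k + k)) <⟨ +-monoʳ-< (A * (L + 3)) 4+2k<5A ⟩
    A * (L + 3) + 5 * A         ≡⟨ factor A L ⟩
    A * (L + 8)                 ≤⟨ *-mono-≤ A≤T (≤-trans L+8≤A A≤T) ⟩
    T * T                       ∎
  where
  open ≤-Reasoning
  factor : ∀ A L → A * (L + 3) + 5 * A ≡ A * (L + 8)
  factor = solve-∀
  5A : ∀ A → 3 * A + (A + A) ≡ 5 * A
  5A = solve-∀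
  4+2k<5A : 4 + (k + k) < 5 * A
  4+2k<5A = begin-strict
    4 + (k + k)     <⟨ +-monoˡ-< (k + k) (≤-trans (≤ᵇ⇒≤ 5 48 tt) (*-monoʳ-≤ 3 16≤A)) ⟩
    3 * A + (k + k) ≤⟨ +-monoʳ-≤ (3 * A) (+-mono-≤ k≤A k≤A) ⟩
    3 * A + (A + A) ≡⟨ 5A A ⟩
    5 * A           ∎

-- At k = 1 the estimate hintikkaLength k 0 + 8 ≤ #types k 0 fails; the bound is computed instead.
normalForm-length-< : ∀ k l → 1 ≤ k → IsLogStar k l →
  #types k 0 * (hintikkaLength k 0 + 3) + (4 + (k + k)) < 3 * (Tower (k + l + 2) * Tower (k + l + 2))
normalForm-length-< 1             zero    _ _              = <ᵇ⇒< _ _ tt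
normalForm-length-< 1             (suc l) _ (_ , minimal)  = contradiction (minimal 0 z<s) (<-irrefl refl)
normalForm-length-< (suc (suc d)) l       _ (k≤Tower , _) = <-≤-trans
  (A*[L+3]+[4+2k]<T*T (≤-trans (16≤#types d 0) (<⇒≤ (n<2^n _))) (d≤#types k 0)
     (hintikkaLength-bound (suc d) 0 z<s) (#types-≤-Tower l k 0 k≤Tower))
  (m≤n*m _ 3)
  where k = suc (suc d)

theorem2p4 : (k : ℕ) → 1 ≤ k → (l : ℕ) → IsLogStar k l →
    ((n : ℕ) (φs : Fin n → Formula) →
       ((i : Fin n) → IsSentence (φs i) × qd (φs i) ≡ k) →
       ((i j : Fin n) → i ≢ j → ¬ Equivalent (φs i) (φs j)) →
       n ≤ Tower (k + l + 3))
    ×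
    ((Φ : Formula) → IsSentence Φ → qd Φ ≡ k →
       Σ Formula (λ Φ' → IsSentence Φ' × qd Φ' ≡ k × Equivalent Φ Φ' ×
         len Φ' < 3 * (Tower (k + l + 2) * Tower (k + l + 2))))
theorem2p4 k 1≤k l logStar@(k≤Tower , _) = count , normalise
  where
  count = λ n φs sentences distinct → begin
    n                       ≤⟨ inequivalent-sentences-≤ k n φs sentences distinct ⟩
    2 ^ #types k 0          ≤⟨ ^-monoʳ-≤ 2 (#types-≤-Tower l k 0 k≤Tower) ⟩
    Tower (suc (k + l + 2)) ≡⟨ cong Tower (sym (+-suc (k + l) 2)) ⟩
    Tower (k + l + 3)       ∎
    where open ≤-Reasoning
  normalise = λ Φ closed depth →
    normalForm k Φ , normalForm-isSentence k Φ 1≤k , normalForm-qd k Φ ,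
    normalForm-equivalent k Φ closed (≤-reflexive depth) ,
    ≤-<-trans (len-normalForm k Φ) (normalForm-length-< k l 1≤k logStar)
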